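{- Let $\mathcal{A}$ be an MPFS algorithm for $\mathrm{OFA}(S,1)$ with $|S|=k$, let $\sigma=r_1\cdots r_k$ be a request sequence, let $1\le i\le k$ and let $s\in F_{i-1}(\mathcal{A})$ with $s\neq s_{\mathcal{A}}(r_i;\sigma)$. Then there exist an index $t^*\ge i$ and servers $\{a_t\}_{t=i}^{t^*}$, $\{h_t\}_{t=i}^{t^*}$ such that (1) $F_t(\mathcal{A})\setminus F_t(\mathcal{H}_{i,s})=\{a_t\}$ and $F_t(\mathcal{H}_{i,s})\setminus F_t(\mathcal{A})=\{h_t\}$ for each $i\le t\le t^*$, and (2) $F_t(\mathcal{A})=F_t(\mathcal{H}_{i,s})$ for each $t\ge t^*+1$.
   Context: Online facility assignment $\mathrm{OFA}(S,1)$ on a metric space $(X,d)$: $S$ is a set of $k$ servers at points of $X$, each of capacity 1; requests $r_1,\ldots,r_n$ ($n\le k$), points of $X$, arrive one at a time and each must be irrevocably matched upon arrival with a free (not yet matched) server, at cost equal to the distance. $s_{\mathcal{A}}(r_i;\sigma)$ is the server with which algorithm $\mathcal{A}$ matches $r_i$ when processing $\sigma$; $F_i(\mathcal{A})$ is the set of free servers just after $\mathcal{A}$ matches $r_i$ ($F_0$ is all of $S$). An algorithm is MPFS (most preferred free servers) if for each request $r_i$ a priority order on all servers is determined solely by the position of $r_i$, and $r_i$ is matched with the free server of highest priority. Hybrid algorithm: for $i\ge1$ and $s\in F_{i-1}(\mathcal{A})$, $\mathcal{H}_{i,s}=\mathcal{H}^{\mathcal{A}}_{i,s}$ matches $r_1,\ldots,r_{i-1}$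 with the same servers as $\mathcal{A}$, matches $r_i$ with $s$, and matches each subsequent request $r_{i+1},r_{i+2},\ldots$ according to $\mathcal{A}$'s rule, i.e. with the free server (among its own current free servers) of highest priority for that request. -}

module Defs where

open import Data.Nat using (ℕ; zero; suc)
open import Data.Fin using (Fin)
open import Data.Fin.Subset using (Subset; _-_)
open import Data.Bool using (true; false)
open import Data.Maybe using (Maybe; just; nothing)
open import Data.List using (List; []; _∷_)
open import Data.Vec using (lookup)

-- An MPFS algorithm is given by  pref : X → List (Fin k) : for a request at
-- position x, pref x lists all servers in decreasing priority (a permutation
-- of allFin k, imposed as a hypothesis in the statement).

firstFree : ∀ {k} → List (Fin k) → Subset k → Maybe (Fin k)
firstFree []       F = nothing
firstFree (s ∷ ss) F with lookup F s
... | true  = just s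
... | false = firstFree ss F

choose : ∀ {k} {X : Set} → (X → List (Fin k)) → Subset k → X → Maybe (Fin k)
choose pref F x = firstFree (pref x) F

serve : ∀ {k} {X : Set} → (X → List (Fin k)) → Subset k → X → Subset k
serve pref F x with choose pref F x
... | just s  = F - s
... | nothing = F

run : ∀ {k} {X : Set} → (X → List (Fin k)) → Subset k → List X → ℕ → Subset k
run pref F xs       zero    = F
run pref F []       (suc t) = F
run pref F (x ∷ xs) (suc t) = run pref (serve pref F x) xs t

-- hrun pref F xs j s t : free servers after t requests for the hybrid that
-- serves the first j requests by the MPFS rule, the (j+1)-th request with
-- server s, and all later requests by the MPFS rule.
hrun : ∀ {k} {X : Set} → (X → List (Fin k)) → Subset k → List X → ℕ → Fin k → ℕ → Subset k
hrun pref F xs       j       s zero    = F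
hrun pref F []       j       s (suc t) = F
hrun pref F (x ∷ xs) zero    s (suc t) = run pref (F - s) xs t
hrun pref F (x ∷ xs) (suc j) s (suc t) = hrun pref (serve pref F x) xs j s t

{-# OPTIONS --safe #-}
-- Just after r_i the free sets of A and of H_{i,s} differ by a swap: A still has s,
-- H still has the server c that A gave to r_i. Two free sets differing by a swap
-- a ↔ h scan the same priority list identically up to the first of a, h, or a
-- commonly free server. If a common server comes first, both take it and the swap
-- persists; if a comes first, A takes a while H takes the next free server q of
-- the list, so the sets coincide when q = h and otherwise differ by the swap q ↔ h
-- (symmetrically if h comes first). Equal free sets stay equal, which gives t*.
module Submission where

open import Defs
open import Data.Nat using (ℕ; zero; suc; _+_; _∸_; _≤_; z≤n; s≤s)
open import Data.Nat.Properties
  using (+-suc; m+n∸m≡n; +-cancelˡ-≤; +-cancelˡ-<; m≤n⇒∃[o]m+o≡n; m≤m+n; ≤-trans; <⇒≤)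
open import Data.Fin using (Fin; zero; suc; toℕ; _≟_)
open import Data.Fin.Subset using (Subset; ⊤; ⁅_⁆; _─_; _-_; _∈_)
open import Data.Bool using (Bool; true; false; if_then_else_)
open import Data.Maybe using (just)
open import Data.List using (List; []; _∷_; drop; length; allFin)
open import Data.List.Membership.Propositional using () renaming (_∈_ to _∈ₗ_)
open import Data.List.Membership.Propositional.Properties using (∈-allFin)
open import Data.List.Relation.Unary.Any using (here; there; tail)
open import Data.List.Relation.Binary.Permutation.Propositional using (_↭_; ↭-sym)
open import Data.List.Relation.Binary.Permutation.Propositional.Properties using (∈-resp-↭)
open import Data.Vec using (Vec; []; _∷_; toList; lookup; tabulate)
open import Data.Vec.Properties
  using (lookup-replicate; []=⇒lookup; length-toList; tabulate∘lookup; tabulate-cong)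
open import Data.Product using (Σ; _×_; _,_)
open import Data.Empty using (⊥-elim)
open import Function using (_∘_)
open import Relation.Nullary using (yes; no)
open import Relation.Binary.PropositionalEquality
  using (_≡_; _≢_; refl; sym; trans; cong; subst; module ≡-Reasoning)
open ≡-Reasoning

lookup-─ : ∀ {n} (p q : Subset n) i → lookup (p ─ q) i ≡ (if lookup q i then false else lookup p i)
lookup-─ (x ∷ p) (true  ∷ q) zero    = refl
lookup-─ (x ∷ p) (false ∷ q) zero    = refl
lookup-─ (x ∷ p) (y     ∷ q) (suc i) = lookup-─ p q i

lookup-⁅i⁆-i : ∀ {n} (i : Fin n) → lookup ⁅ i ⁆ i ≡ true
lookup-⁅i⁆-i zero    = refl
lookup-⁅i⁆-i (suc i) = lookup-⁅i⁆-i i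

lookup-⁅j⁆-i : ∀ {n} {i j : Fin n} → i ≢ j → lookup ⁅ j ⁆ i ≡ false
lookup-⁅j⁆-i {i = zero}  {zero}  i≢j = ⊥-elim (i≢j refl)
lookup-⁅j⁆-i {i = suc i} {zero}  i≢j = lookup-replicate i false
lookup-⁅j⁆-i {i = zero}  {suc j} i≢j = refl
lookup-⁅j⁆-i {i = suc i} {suc j} i≢j = lookup-⁅j⁆-i (λ i≡j → i≢j (cong suc i≡j))

lookup-p-i-i : ∀ {n} (p : Subset n) i → lookup (p - i) i ≡ false
lookup-p-i-i p i rewrite lookup-─ p ⁅ i ⁆ i | lookup-⁅i⁆-i i = refl

lookup-p-j-i : ∀ {n} (p : Subset n) {i j} → i ≢ j → lookup (p - j) i ≡ lookup p i
lookup-p-j-i p {i} {j} i≢j rewrite lookup-─ p ⁅ j ⁆ i | lookup-⁅j⁆-i i≢j = refl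

lookup-injective : ∀ {A : Set} {n} {xs ys : Vec A n} →
                   (∀ i → lookup xs i ≡ lookup ys i) → xs ≡ ys
lookup-injective {xs = xs} {ys} xs≗ys = begin
  xs                   ≡⟨ sym (tabulate∘lookup xs) ⟩
  tabulate (lookup xs) ≡⟨ tabulate-cong xs≗ys ⟩
  tabulate (lookup ys) ≡⟨ tabulate∘lookup ys ⟩
  ys                   ∎

true≢false : true ≢ false
true≢false ()

-- A ─ H = ⁅ a ⁆ and H ─ A = ⁅ h ⁆, stated pointwise.
record Swap {n} (a h : Fin n) (A H : Subset n) : Set where
  field
    a∈A   : lookup A a ≡ true
    a∉H   : lookup H a ≡ false
    h∉A   : lookup A h ≡ false
    h∈H   : lookup H h ≡ true
    agree : ∀ i → i ≢ a → i ≢ h → lookup A i ≡ lookup H i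
open Swap

Swap-sym : ∀ {n} {a h : Fin n} {A H} → Swap a h A H → Swap h a H A
Swap-sym S = record
  { a∈A = h∈H S ; a∉H = h∉A S ; h∉A = a∉H S ; h∈H = a∈A S
  ; agree = λ i i≢h i≢a → sym (agree S i i≢a i≢h) }

Swap⇒≢ : ∀ {n} {a h : Fin n} {A H} → Swap a h A H → a ≢ h
Swap⇒≢ S refl = true≢false (trans (sym (a∈A S)) (h∉A S))

Swap⇒─ : ∀ {n} {a h : Fin n} {A H} → Swap a h A H → A ─ H ≡ ⁅ a ⁆
Swap⇒─ {a = a} {h} {A} {H} S = lookup-injective pointwise
  where
  if-same : ∀ (x y : Bool) → x ≡ y → (if y then false else x) ≡ false
  if-same true  true  _ = refl
  if-same false false _ = refl
  pointwise : ∀ i → lookup (A ─ H) i ≡ lookup ⁅ a ⁆ i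
  pointwise i rewrite lookup-─ A H i with i ≟ a
  ... | yes refl rewrite a∉H S | a∈A S | lookup-⁅i⁆-i a = refl
  ... | no i≢a with i ≟ h
  ...   | yes refl rewrite h∈H S | lookup-⁅j⁆-i (λ h≡a → Swap⇒≢ S (sym h≡a)) = refl
  ...   | no i≢h rewrite lookup-⁅j⁆-i i≢a = if-same (lookup A i) (lookup H i) (agree S i i≢a i≢h)

remove-Swap : ∀ {n} {G : Subset n} {a h} →
              lookup G a ≡ true → lookup G h ≡ true → a ≢ h → Swap a h (G - h) (G - a)
remove-Swap {G = G} a∈G h∈G a≢h = record
  { a∈A = trans (lookup-p-j-i G a≢h) a∈G
  ; a∉H = lookup-p-i-i G _
  ; h∉A = lookup-p-i-i G _
  ; h∈H = trans (lookup-p-j-i G (λ h≡a → a≢h (sym h≡a))) h∈G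
  ; agree = λ i i≢a i≢h → trans (lookup-p-j-i G i≢h) (sym (lookup-p-j-i G i≢a)) }

firstFree-∷-free : ∀ {n} (F : Subset n) {y} ys → lookup F y ≡ true → firstFree (y ∷ ys) F ≡ just y
firstFree-∷-free F ys y∈F rewrite y∈F = refl

firstFree-∷-taken : ∀ {n} (F : Subset n) {y} ys →
                    lookup F y ≡ false → firstFree (y ∷ ys) F ≡ firstFree ys F
firstFree-∷-taken F ys y∉F rewrite y∉F = refl

firstFree⇒free : ∀ {n} (ys : List (Fin n)) {F y} → firstFree ys F ≡ just y → lookup F y ≡ true
firstFree⇒free []       ()
firstFree⇒free (z ∷ ys) {F} e with lookup F z in z∈F
firstFree⇒free (z ∷ ys) refl | true  = z∈F
firstFree⇒free (z ∷ ys) e    | false = firstFree⇒free ys e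

firstFree-complete : ∀ {n} (ys : List (Fin n)) {F y} → y ∈ₗ ys → lookup F y ≡ true →
                     Σ (Fin n) λ q → firstFree ys F ≡ just q
firstFree-complete (z ∷ ys) {F} y∈ys y∈F with lookup F z in z∈F
... | true = z , refl
firstFree-complete (z ∷ ys) (here refl) y∈F | false = ⊥-elim (true≢false (trans (sym y∈F) z∈F))
firstFree-complete (z ∷ ys) (there y∈ys) y∈F | false = firstFree-complete ys y∈ys y∈F

data FirstFreeUnderSwap {n} (a h : Fin n) (A H : Subset n) (ys : List (Fin n)) : Set where
  common : ∀ y → firstFree ys A ≡ just y → firstFree ys H ≡ just y → FirstFreeUnderSwap a h A H ys
  A-a    : ∀ q → firstFree ys A ≡ just a → firstFree ys H ≡ just q → FirstFreeUnderSwap a h A H ys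
  H-h    : ∀ p → firstFree ys A ≡ just p → firstFree ys H ≡ just h → FirstFreeUnderSwap a h A H ys

FirstFreeUnderSwap-skip : ∀ {n} {a h : Fin n} {A H ys zs} →
                          firstFree ys A ≡ firstFree zs A → firstFree ys H ≡ firstFree zs H →
                          FirstFreeUnderSwap a h A H zs → FirstFreeUnderSwap a h A H ys
FirstFreeUnderSwap-skip eA eH (common y pA pH) = common y (trans eA pA) (trans eH pH)
FirstFreeUnderSwap-skip eA eH (A-a q pA pH)    = A-a q (trans eA pA) (trans eH pH)
FirstFreeUnderSwap-skip eA eH (H-h p pA pH)    = H-h p (trans eA pA) (trans eH pH)

firstFree-under-Swap : ∀ {n} {a h : Fin n} {A H} (ys : List (Fin n)) →
                       Swap a h A H → a ∈ₗ ys → h ∈ₗ ys → FirstFreeUnderSwap a h A H ys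
firstFree-under-Swap {a = a} {h} {A} {H} (y ∷ ys) S a∈ys h∈ys with y ≟ a | y ≟ h
... | yes refl | _ with firstFree-complete ys (tail (Swap⇒≢ S ∘ sym) h∈ys) (h∈H S)
...   | q , e = A-a q (firstFree-∷-free A ys (a∈A S)) (trans (firstFree-∷-taken H ys (a∉H S)) e)
firstFree-under-Swap {a = a} {h} {A} {H} (y ∷ ys) S a∈ys h∈ys | no _ | yes refl
  with firstFree-complete ys (tail (Swap⇒≢ S) a∈ys) (a∈A S)
... | p , e = H-h p (trans (firstFree-∷-taken A ys (h∉A S)) e) (firstFree-∷-free H ys (h∈H S))
firstFree-under-Swap {a = a} {h} {A} {H} (y ∷ ys) S a∈ys h∈ys | no y≢a | no y≢h
  with lookup A y in y∈A | agree S y y≢a y≢h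
... | true  | A≡H = common y (firstFree-∷-free A ys y∈A) (firstFree-∷-free H ys (sym A≡H))
... | false | A≡H =
  FirstFreeUnderSwap-skip (firstFree-∷-taken A ys y∈A) (firstFree-∷-taken H ys (sym A≡H))
    (firstFree-under-Swap ys S (tail (y≢a ∘ sym) a∈ys) (tail (y≢h ∘ sym) h∈ys))

data SwapOrEqual {n} (A H : Subset n) : Set where
  equal : A ≡ H → SwapOrEqual A H
  swap  : ∀ a h → Swap a h A H → SwapOrEqual A H

SwapOrEqual-sym : ∀ {n} {A H : Subset n} → SwapOrEqual A H → SwapOrEqual H A
SwapOrEqual-sym (equal A≡H)  = equal (sym A≡H)
SwapOrEqual-sym (swap a h S) = swap h a (Swap-sym S)

Swap-remove-common : ∀ {n} {a h y : Fin n} {A H} → Swap a h A H →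
                     lookup A y ≡ true → lookup H y ≡ true → Swap a h (A - y) (H - y)
Swap-remove-common {a = a} {h} {y} {A} {H} S y∈A y∈H = record
  { a∈A = trans (lookup-p-j-i A a≢y) (a∈A S)
  ; a∉H = trans (lookup-p-j-i H a≢y) (a∉H S)
  ; h∉A = trans (lookup-p-j-i A h≢y) (h∉A S)
  ; h∈H = trans (lookup-p-j-i H h≢y) (h∈H S)
  ; agree = agree-y }
  where
  a≢y : a ≢ y
  a≢y refl = true≢false (trans (sym y∈H) (a∉H S))
  h≢y : h ≢ y
  h≢y refl = true≢false (trans (sym y∈A) (h∉A S))
  agree-y : ∀ i → i ≢ a → i ≢ h → lookup (A - y) i ≡ lookup (H - y) i
  agree-y i i≢a i≢h with i ≟ y
  ... | yes refl = trans (lookup-p-i-i A i) (sym (lookup-p-i-i H i))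
  ... | no i≢y   =
    trans (lookup-p-j-i A i≢y) (trans (agree S i i≢a i≢h) (sym (lookup-p-j-i H i≢y)))

Swap-remove-a : ∀ {n} {a h q : Fin n} {A H} → Swap a h A H →
                lookup H q ≡ true → SwapOrEqual (A - a) (H - q)
Swap-remove-a {a = a} {h} {q} {A} {H} S q∈H with q ≟ h
... | yes refl = equal (lookup-injective same)
  where
  same : ∀ i → lookup (A - a) i ≡ lookup (H - q) i
  same i with i ≟ a | i ≟ q
  ... | yes refl | _        =
    trans (lookup-p-i-i A i) (sym (trans (lookup-p-j-i H (Swap⇒≢ S)) (a∉H S)))
  ... | no i≢a   | yes refl = trans (lookup-p-j-i A i≢a) (trans (h∉A S) (sym (lookup-p-i-i H i)))
  ... | no i≢a   | no i≢q   =
    trans (lookup-p-j-i A i≢a) (trans (agree S i i≢a i≢q) (sym (lookup-p-j-i H i≢q)))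
... | no q≢h = swap q h (record
  { a∈A = trans (lookup-p-j-i A q≢a) (trans (agree S q q≢a q≢h) q∈H)
  ; a∉H = lookup-p-i-i H q
  ; h∉A = trans (lookup-p-j-i A (Swap⇒≢ S ∘ sym)) (h∉A S)
  ; h∈H = trans (lookup-p-j-i H (q≢h ∘ sym)) (h∈H S)
  ; agree = agree-q })
  where
  q≢a : q ≢ a
  q≢a refl = true≢false (trans (sym q∈H) (a∉H S))
  agree-q : ∀ i → i ≢ q → i ≢ h → lookup (A - a) i ≡ lookup (H - q) i
  agree-q i i≢q i≢h with i ≟ a
  ... | yes refl = trans (lookup-p-i-i A i) (sym (trans (lookup-p-j-i H i≢q) (a∉H S)))
  ... | no i≢a   =
    trans (lookup-p-j-i A i≢a) (trans (agree S i i≢a i≢h) (sym (lookup-p-j-i H i≢q)))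

record Diverge {k} (A H : ℕ → Subset k) (start end : ℕ) : Set where
  field
    t*       : ℕ
    start≤t* : start ≤ t*
    a h      : ℕ → Fin k
    swapped  : ∀ t → start ≤ t → t ≤ t* → Swap (a t) (h t) (A t) (H t)
    merged   : ∀ t → suc t* ≤ t → t ≤ end → A t ≡ H t

Diverge-now : ∀ {k} {A H : ℕ → Subset k} {a h end} → Swap a h (A 0) (H 0) →
              (∀ t → 1 ≤ t → t ≤ end → A t ≡ H t) → Diverge A H 0 end
Diverge-now {a = a} {h} S merged = record
  { t* = 0 ; start≤t* = z≤n ; a = λ _ → a ; h = λ _ → h
  ; swapped = λ { zero _ _ → S } ; merged = merged }

Diverge-cons : ∀ {k} {A H : ℕ → Subset k} {a h end} → Swap a h (A 0) (H 0) →
               Diverge (A ∘ suc) (H ∘ suc) 0 end → Diverge A H 0 (suc end)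
Diverge-cons {a = a} {h} S D = record
  { t* = suc t* ; start≤t* = z≤n
  ; a = λ { zero → a ; (suc t) → Diverge.a D t }
  ; h = λ { zero → h ; (suc t) → Diverge.h D t }
  ; swapped = λ { zero _ _ → S ; (suc t) _ (s≤s t≤t*) → swapped t z≤n t≤t* }
  ; merged = λ { (suc t) (s≤s t*<t) (s≤s t≤end) → merged t t*<t t≤end } }
  where open Diverge D using (t*; swapped; merged)

Diverge-shift : ∀ {k} {A H A′ H′ : ℕ → Subset k} n {end} →
                (∀ u → A (n + u) ≡ A′ u) → (∀ u → H (n + u) ≡ H′ u) →
                Diverge A′ H′ 0 end → Diverge A H n (n + end)
Diverge-shift {A = A} {H} {A′} {H′} n {end} A≡A′ H≡H′ D = record
  { t* = n + t* ; start≤t* = m≤m+n n t*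
  ; a = λ t → a (t ∸ n) ; h = λ t → h (t ∸ n)
  ; swapped = swapped-shifted ; merged = merged-shifted }
  where
  open Diverge D
  swapped-shifted : ∀ t → n ≤ t → t ≤ n + t* → Swap (a (t ∸ n)) (h (t ∸ n)) (A t) (H t)
  swapped-shifted t n≤t t≤ with m≤n⇒∃[o]m+o≡n n≤t
  ... | u , refl rewrite m+n∸m≡n n u | A≡A′ u | H≡H′ u =
    swapped u z≤n (+-cancelˡ-≤ n u t* t≤)
  merged-shifted : ∀ t → suc (n + t*) ≤ t → t ≤ n + end → A t ≡ H t
  merged-shifted t n+t*<t t≤ with m≤n⇒∃[o]m+o≡n (≤-trans (m≤m+n n t*) (<⇒≤ n+t*<t))
  ... | u , refl = begin
    A (n + u) ≡⟨ A≡A′ u ⟩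
    A′ u      ≡⟨ merged u (+-cancelˡ-< n t* u n+t*<t) (+-cancelˡ-≤ n u end t≤) ⟩
    H′ u      ≡⟨ sym (H≡H′ u) ⟩
    H (n + u) ∎

module MPFS {X : Set} {k : ℕ} (pref : X → List (Fin k))
            (complete : ∀ x (y : Fin k) → y ∈ₗ pref x) where

  serve-chosen : ∀ F x {y} → choose pref F x ≡ just y → serve pref F x ≡ F - y
  serve-chosen F x chosen rewrite chosen = refl

  serve-Swap : ∀ {a h A H} x → Swap a h A H → SwapOrEqual (serve pref A x) (serve pref H x)
  serve-Swap {a} {h} {A} {H} x S with firstFree-under-Swap (pref x) S (complete x a) (complete x h)
  ... | common y eA eH rewrite serve-chosen A x eA | serve-chosen H x eH =
    swap a h (Swap-remove-common S (firstFree⇒free (pref x) eA) (firstFree⇒free (pref x) eH))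
  ... | A-a q eA eH rewrite serve-chosen A x eA | serve-chosen H x eH =
    Swap-remove-a S (firstFree⇒free (pref x) eH)
  ... | H-h p eA eH rewrite serve-chosen A x eA | serve-chosen H x eH =
    SwapOrEqual-sym (Swap-remove-a (Swap-sym S) (firstFree⇒free (pref x) eA))

  run-Swap : ∀ xs {a h A H} → Swap a h A H → Diverge (run pref A xs) (run pref H xs) 0 (length xs)
  run-Swap []       S = Diverge-now S (λ { (suc t) _ () })
  run-Swap (x ∷ xs) S with serve-Swap x S
  ... | equal A≡H    = Diverge-now S (λ { (suc t) _ _ → cong (λ F → run pref F xs t) A≡H })
  ... | swap a h S′  = Diverge-cons S (run-Swap xs S′)

  run-[] : ∀ F t → run pref F [] t ≡ F
  run-[] F zero    = refl
  run-[] F (suc t) = refl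

  hrun-[] : ∀ F m s t → hrun pref F [] m s t ≡ F
  hrun-[] F m s zero    = refl
  hrun-[] F m s (suc t) = refl

  run-+ : ∀ F xs m t → run pref F xs (m + t) ≡ run pref (run pref F xs m) (drop m xs) t
  run-+ F xs       zero    t = refl
  run-+ F []       (suc m) t = sym (run-[] F t)
  run-+ F (x ∷ xs) (suc m) t = run-+ (serve pref F x) xs m t

  hrun-+ : ∀ F xs m s t → hrun pref F xs m s (m + t) ≡ hrun pref (run pref F xs m) (drop m xs) 0 s t
  hrun-+ F xs       zero    s t = refl
  hrun-+ F []       (suc m) s t = sym (hrun-[] F 0 s t)
  hrun-+ F (x ∷ xs) (suc m) s t = hrun-+ (serve pref F x) xs m s t

  hybrid-diverges : ∀ F xs m {x rest} s → drop m xs ≡ x ∷ rest →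
                    lookup (run pref F xs m) s ≡ true → choose pref (run pref F xs m) x ≢ just s →
                    Diverge (run pref F xs) (hrun pref F xs m s) (suc m) (suc m + length rest)
  hybrid-diverges F xs m {x} {rest} s xs-from-m s∈G c≢s
    with firstFree-complete (pref x) (complete x s) s∈G
  ... | c , chosen = Diverge-shift (suc m) run-after run-after-hybrid
                       (run-Swap rest (remove-Swap s∈G (firstFree⇒free (pref x) chosen) s≢c))
    where
    G = run pref F xs m
    s≢c : s ≢ c
    s≢c s≡c = c≢s (trans chosen (cong just (sym s≡c)))
    run-after : ∀ u → run pref F xs (suc m + u) ≡ run pref (G - c) rest u
    run-after u = begin
      run pref F xs (suc m + u)         ≡⟨ cong (run pref F xs) (sym (+-suc m u)) ⟩
      run pref F xs (m + suc u)         ≡⟨ run-+ F xs m (suc u) ⟩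
      run pref G (drop m xs) (suc u)    ≡⟨ cong (λ ys → run pref G ys (suc u)) xs-from-m ⟩
      run pref (serve pref G x) rest u  ≡⟨ cong (λ F′ → run pref F′ rest u) (serve-chosen G x chosen) ⟩
      run pref (G - c) rest u           ∎
    run-after-hybrid : ∀ u → hrun pref F xs m s (suc m + u) ≡ run pref (G - s) rest u
    run-after-hybrid u = begin
      hrun pref F xs m s (suc m + u)         ≡⟨ cong (hrun pref F xs m s) (sym (+-suc m u)) ⟩
      hrun pref F xs m s (m + suc u)         ≡⟨ hrun-+ F xs m s (suc u) ⟩
      hrun pref G (drop m xs) 0 s (suc u)    ≡⟨ cong (λ ys → hrun pref G ys 0 s (suc u)) xs-from-m ⟩
      run pref (G - s) rest u                ∎

drop-toList-lookup : ∀ {X : Set} {k} (σ : Vec X k) (j : Fin k) →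
                     Σ (List X) λ rest → (drop (toℕ j) (toList σ) ≡ lookup σ j ∷ rest)
                                         × (suc (toℕ j) + length rest ≡ k)
drop-toList-lookup (x ∷ σ) zero    = toList σ , refl , cong suc (length-toList σ)
drop-toList-lookup (x ∷ σ) (suc j) with drop-toList-lookup σ j
... | rest , σ-from-j , length-rest = rest , σ-from-j , cong suc length-rest

lemma3 : {X : Set} (k : ℕ) (pref : X → List (Fin k)) →
         (∀ x → pref x ↭ allFin k) →
         (σ : Vec X k) (j : Fin k) (s : Fin k) →
         s ∈ run pref ⊤ (toList σ) (toℕ j) →
         choose pref (run pref ⊤ (toList σ) (toℕ j)) (lookup σ j) ≢ just s →
         Σ ℕ λ tstar → suc (toℕ j) ≤ tstar ×
           Σ (ℕ → Fin k) λ a → Σ (ℕ → Fin k) λ h →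
             (∀ t → suc (toℕ j) ≤ t → t ≤ tstar →
                (run pref ⊤ (toList σ) t ─ hrun pref ⊤ (toList σ) (toℕ j) s t ≡ ⁅ a t ⁆)
                × (hrun pref ⊤ (toList σ) (toℕ j) s t ─ run pref ⊤ (toList σ) t ≡ ⁅ h t ⁆))
             × (∀ t → suc tstar ≤ t → t ≤ k →
                run pref ⊤ (toList σ) t ≡ hrun pref ⊤ (toList σ) (toℕ j) s t)
lemma3 k pref perm σ j s s∈F c≢s with drop-toList-lookup σ j
... | rest , σ-from-j , length-rest =
  t* , start≤t* , a , h
  , (λ t i≤t t≤t* → Swap⇒─ (swapped t i≤t t≤t*) , Swap⇒─ (Swap-sym (swapped t i≤t t≤t*)))
  , merged
  where
  open MPFS pref (λ x y → ∈-resp-↭ (↭-sym (perm x)) (∈-allFin y))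
  open Diverge (subst (Diverge _ _ _) length-rest
                  (hybrid-diverges ⊤ (toList σ) (toℕ j) s σ-from-j ([]=⇒lookup s∈F) c≢s))
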